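{- Let $q\geq 3$ and let $\mathcal{C}\subseteq Q^3$ be a $(3,M,q)$ code over an alphabet $Q$ with $|Q|=q$. Then $\mathcal{C}$ is a $\overline{3}$-SSC$(3,M,q)$ if and only if $\mathcal{C}$ is a $\overline{3}$-SC$(3,M,q)$.
   Context: An $(n,M,q)$ code is a set $\mathcal{C}=\{\mathbf{c}_1,\dots,\mathbf{c}_M\}\subseteq Q^n$ of $M$ distinct words (codewords), where $|Q|=q$. For $\mathcal{C}_0\subseteq\mathcal{C}$ and $1\le i\le n$, let $\mathcal{C}_0(i)=\{\mathbf{c}(i):\mathbf{c}\in\mathcal{C}_0\}$ (the set of $i$-th coordinates), and define the descendant set $\mathsf{desc}(\mathcal{C}_0)=\mathcal{C}_0(1)\times\cdots\times\mathcal{C}_0(n)$. For an integer $t\ge 2$: $\mathcal{C}$ is a $\overline{t}$-separable code ($\overline{t}$-SC$(n,M,q)$) if for any $\mathcal{C}_1,\mathcal{C}_2\subseteq\mathcal{C}$ with $1\le|\mathcal{C}_1|,|\mathcal{C}_2|\le t$ and $\mathcal{C}_1\ne\mathcal{C}_2$, we have $\mathsf{desc}(\mathcal{C}_1)\ne\mathsf{desc}(\mathcal{C}_2)$. $\mathcal{C}$ is a strongly $\overline{t}$-separable code ($\overline{t}$-SSC$(n,M,q)$) if for every $\mathcal{C}_0\subseteq\mathcal{C}$ with $1\le|\mathcal{C}_0|\le t$ we have $\bigcap_{\mathcal{C}'\in S(\mathcal{C}_0)}\mathcal{C}'=\mathcal{C}_0$, where $S(\mathcal{C}_0)=\{\mathcal{C}'\subseteq\mathcal{C}:\mathsf{desc}(\mathcal{C}')=\mathsf{desc}(\mathcal{C}_0)\}$.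 -}

module Defs where

open import Data.Nat using (ℕ; _≤_)
open import Data.Fin using (Fin)
open import Data.Fin.Subset using (Subset; _∈_; ∣_∣)
open import Data.Vec using (Vec; lookup)
open import Data.Product using (Σ; ∃; _×_)
open import Relation.Binary.PropositionalEquality using (_≡_; _≢_)
open import Relation.Nullary using (¬_)
open import Function.Bundles using (_⇔_)
open import Function.Definitions using (Injective)

Word : ℕ → ℕ → Set
Word n q = Vec (Fin q) n

-- Subcodes C_0 ⊆ C are identified with subsets of
-- the index set Fin M (a bijective correspondence since the indexing is
-- injective).
record Code (n M q : ℕ) : Set where
  field
    word     : Fin M → Word n q
    distinct : Injective _≡_ _≡_ word
open Code public

module _ {n M q : ℕ} (C : Code n M q) where

  -- w ∈ desc(C₀) = C₀(1) × ... × C₀(n):  for every coordinate i, w(i) ∈ C₀(i).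
  InDesc : Subset M → Word n q → Set
  InDesc C₀ w = (i : Fin n) → Σ (Fin M) λ j → (j ∈ C₀) × (lookup (word C j) i ≡ lookup w i)

  SameDesc : Subset M → Subset M → Set
  SameDesc C₁ C₂ = (w : Word n q) → InDesc C₁ w ⇔ InDesc C₂ w

  IsSC : ℕ → Set
  IsSC t = (C₁ C₂ : Subset M) →
           1 ≤ ∣ C₁ ∣ → ∣ C₁ ∣ ≤ t → 1 ≤ ∣ C₂ ∣ → ∣ C₂ ∣ ≤ t →
           C₁ ≢ C₂ → ¬ SameDesc C₁ C₂

  -- Membership in ⋂_{C' ∈ S(C₀)} C', where S(C₀) = {C' ⊆ C : desc C' = desc C₀}.
  InIntersectionS : Subset M → Fin M → Set
  InIntersectionS C₀ j = (C' : Subset M) → SameDesc C' C₀ → j ∈ C'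

  IsSSC : ℕ → Set
  IsSSC t = (C₀ : Subset M) → 1 ≤ ∣ C₀ ∣ → ∣ C₀ ∣ ≤ t →
            (j : Fin M) → InIntersectionS C₀ j ⇔ (j ∈ C₀)

module Submission where

-- For any length n and any t, a code is t̄-SSC iff every subcode C₀ with
-- 1 ≤ |C₀| ≤ t is contained in every subcode C' with desc C' = desc C₀
-- (ssc⇔included), and this inclusion property implies t̄-SC (included⇒sc).
-- So the theorem reduces to: in a 3̄-SC code of length 3, a ∈ C₀ (|C₀| ≤ 3)
-- and a ∉ C' with desc C' = desc C₀ is impossible.
--
-- Write C₀ ⊆ {a, b, c}.  Since a ∈ desc C', every letter of a is "echoed" at
-- its coordinate by a codeword w ≠ a of C', which is a descendant of
-- {a, b, c}.  All contradictions come from one tool (separate): two triples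
-- of codewords covering each other letter by letter have equal descendant
-- sets, so by 3̄-SC they coincide.  If every letter of a also occurs in b or
-- c, then {a, b, c} and {b, c} cover each other.  Otherwise a has a lone coordinate
-- i, and the echo of a at i is a transversal: it reads a, b, c, each letter
-- unique, at three distinct coordinates.  Comparing transversals at the lone
-- coordinates of a, either two of them differ by a transposition (swapped)
-- or three of them form a Latin square (rotation); both contradict 3̄-SC.

open import Defs
open import Data.Nat using (ℕ; _≤_; _+_; z≤n; s≤s)
import Data.Nat.Properties as ℕ
open import Data.Fin using (Fin; zero; suc; _≟_)
open import Data.Fin.Properties using (pigeonhole; all?; ¬∀⟶∃¬)
open import Data.Fin.Subset
  using (Subset; _∈_; _∉_; _⊆_; _∪_; _-_; ⁅_⁆; ∣_∣; inside; outside)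
open import Data.Fin.Subset.Properties
  using (x∈⁅x⁆; x∈⁅y⁆⇒x≡y; x∈p∪q⁻; x∈p∪q⁺; ∣⁅x⁆∣≡1; ⊆-antisym; _∈?_;
         nonempty?; x∈p∧x≢y⇒x∈p-y; x∈p⇒∣p-x∣<∣p∣; p─q⊆p)
open import Data.Vec using (_∷_; []; lookup; there)
open import Data.Product using (Σ-syntax; _×_; _,_)
open import Data.Sum using (_⊎_; inj₁; inj₂; [_,_]′; map₂) renaming (swap to swap⊎)
open import Data.Empty using (⊥; ⊥-elim)
open import Function using (id; _∘_)
open import Function.Bundles using (_⇔_; mk⇔; Equivalence)
open import Relation.Binary.PropositionalEquality
  using (_≡_; _≢_; refl; sym; trans; cong; cong₂; subst)
open import Relation.Nullary using (¬_; Dec; yes; no)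
open import Relation.Nullary.Decidable using (_⊎-dec_)

cover3 : ∀ {i j k : Fin 3} → i ≢ j → i ≢ k → j ≢ k →
         ∀ m → m ≡ i ⊎ m ≡ j ⊎ m ≡ k
cover3 {i} {j} {k} i≢j i≢k j≢k m with m ≟ i | m ≟ j | m ≟ k
... | yes m≡i | _       | _       = inj₁ m≡i
... | no _    | yes m≡j | _       = inj₂ (inj₁ m≡j)
... | no _    | no _    | yes m≡k = inj₂ (inj₂ m≡k)
... | no m≢i  | no m≢j  | no m≢k  with pigeonhole ℕ.≤-refl (lookup (m ∷ i ∷ j ∷ k ∷ []))
... | zero           , suc zero             , _ , e = ⊥-elim (m≢i e)
... | zero           , suc (suc zero)       , _ , e = ⊥-elim (m≢j e)
... | zero           , suc (suc (suc zero)) , _ , e = ⊥-elim (m≢k e)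
... | suc zero       , suc (suc zero)       , _ , e = ⊥-elim (i≢j e)
... | suc zero       , suc (suc (suc zero)) , _ , e = ⊥-elim (i≢k e)
... | suc (suc zero) , suc (suc (suc zero)) , _ , e = ⊥-elim (j≢k e)
... | _              , zero                 , () , _
... | suc zero       , suc zero             , s≤s () , _
... | suc (suc zero) , suc zero             , s≤s () , _
... | suc (suc zero) , suc (suc zero)       , s≤s (s≤s ()) , _
... | suc (suc (suc zero)) , suc zero       , s≤s () , _
... | suc (suc (suc zero)) , suc (suc zero) , s≤s (s≤s ()) , _
... | suc (suc (suc zero)) , suc (suc (suc zero)) , s≤s (s≤s (s≤s ())) , _

byCoordinate : ∀ {P : Fin 3 → Set} {i j k : Fin 3} → i ≢ j → i ≢ k → j ≢ k →
               P i → P j → P k → ∀ m → P m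
byCoordinate i≢j i≢k j≢k Pi Pj Pk m with cover3 i≢j i≢k j≢k m
... | inj₁ refl        = Pi
... | inj₂ (inj₁ refl) = Pj
... | inj₂ (inj₂ refl) = Pk

∣p∪q∣≤∣p∣+∣q∣ : ∀ {n} (p q : Subset n) → ∣ p ∪ q ∣ ≤ ∣ p ∣ + ∣ q ∣
∣p∪q∣≤∣p∣+∣q∣ []            []            = z≤n
∣p∪q∣≤∣p∣+∣q∣ (inside  ∷ p) (inside  ∷ q) =
  s≤s (ℕ.≤-trans (∣p∪q∣≤∣p∣+∣q∣ p q) (ℕ.+-monoʳ-≤ ∣ p ∣ (ℕ.n≤1+n ∣ q ∣)))
∣p∪q∣≤∣p∣+∣q∣ (inside  ∷ p) (outside ∷ q) = s≤s (∣p∪q∣≤∣p∣+∣q∣ p q)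
∣p∪q∣≤∣p∣+∣q∣ (outside ∷ p) (inside  ∷ q) =
  ℕ.≤-trans (s≤s (∣p∪q∣≤∣p∣+∣q∣ p q)) (ℕ.≤-reflexive (sym (ℕ.+-suc ∣ p ∣ ∣ q ∣)))
∣p∪q∣≤∣p∣+∣q∣ (outside ∷ p) (outside ∷ q) = ∣p∪q∣≤∣p∣+∣q∣ p q

x∈p⇒1≤∣p∣ : ∀ {n} {p : Subset n} {x : Fin n} → x ∈ p → 1 ≤ ∣ p ∣
x∈p⇒1≤∣p∣ x∈p = ℕ.≤-trans (s≤s z≤n) (x∈p⇒∣p-x∣<∣p∣ x∈p)

x∉p-x : ∀ {n} (p : Subset n) (x : Fin n) → x ∉ p - x
x∉p-x (_ ∷ p) zero    ()
x∉p-x (_ ∷ p) (suc x) (there x∈p-x) = x∉p-x p x x∈p-x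

y∈p-x⇒y≢x : ∀ {n} {p : Subset n} {x y : Fin n} → y ∈ p - x → y ≢ x
y∈p-x⇒y≢x {p = p} {x} y∈p-x refl = x∉p-x p x y∈p-x

split : ∀ {n} {p : Subset n} {k : Fin n} (x : Fin n) → k ∈ p → k ≡ x ⊎ k ∈ p - x
split {k = k} x k∈p with k ≟ x
... | yes k≡x = inj₁ k≡x
... | no  k≢x = inj₂ (x∈p∧x≢y⇒x∈p-y k∈p k≢x)

-- Triples of elements (repetitions allowed), standing for sets of size ≤ 3.
Triple : ℕ → Set
Triple N = Fin N × Fin N × Fin N

_∈ᵗ_ : ∀ {N} → Fin N → Triple N → Set
k ∈ᵗ (x , y , z) = k ≡ x ⊎ k ≡ y ⊎ k ≡ z

⟦_⟧ : ∀ {N} → Triple N → Subset N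
⟦ x , y , z ⟧ = ⁅ x ⁆ ∪ ⁅ y ⁆ ∪ ⁅ z ⁆

∈⟦⟧⁻ : ∀ {N} {k : Fin N} (T : Triple N) → k ∈ ⟦ T ⟧ → k ∈ᵗ T
∈⟦⟧⁻ (x , y , z) k∈T with x∈p∪q⁻ ⁅ x ⁆ _ k∈T
... | inj₁ k∈x = inj₁ (x∈⁅y⁆⇒x≡y x k∈x)
... | inj₂ k∈yz with x∈p∪q⁻ ⁅ y ⁆ ⁅ z ⁆ k∈yz
...   | inj₁ k∈y = inj₂ (inj₁ (x∈⁅y⁆⇒x≡y y k∈y))
...   | inj₂ k∈z = inj₂ (inj₂ (x∈⁅y⁆⇒x≡y z k∈z))

∈⟦⟧⁺ : ∀ {N} {k : Fin N} (T : Triple N) → k ∈ᵗ T → k ∈ ⟦ T ⟧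
∈⟦⟧⁺ (x , y , z) (inj₁ refl)        = x∈p∪q⁺ (inj₁ (x∈⁅x⁆ x))
∈⟦⟧⁺ (x , y , z) (inj₂ (inj₁ refl)) = x∈p∪q⁺ (inj₂ (x∈p∪q⁺ (inj₁ (x∈⁅x⁆ y))))
∈⟦⟧⁺ (x , y , z) (inj₂ (inj₂ refl)) = x∈p∪q⁺ (inj₂ (x∈p∪q⁺ (inj₂ (x∈⁅x⁆ z))))

∣⟦⟧∣≤3 : ∀ {N} (T : Triple N) → ∣ ⟦ T ⟧ ∣ ≤ 3
∣⟦⟧∣≤3 (x , y , z) = begin
  ∣ ⁅ x ⁆ ∪ ⁅ y ⁆ ∪ ⁅ z ⁆ ∣         ≤⟨ ∣p∪q∣≤∣p∣+∣q∣ ⁅ x ⁆ (⁅ y ⁆ ∪ ⁅ z ⁆) ⟩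
  ∣ ⁅ x ⁆ ∣ + ∣ ⁅ y ⁆ ∪ ⁅ z ⁆ ∣     ≤⟨ ℕ.+-monoʳ-≤ ∣ ⁅ x ⁆ ∣ (∣p∪q∣≤∣p∣+∣q∣ ⁅ y ⁆ ⁅ z ⁆) ⟩
  ∣ ⁅ x ⁆ ∣ + (∣ ⁅ y ⁆ ∣ + ∣ ⁅ z ⁆ ∣) ≡⟨ cong₂ _+_ (∣⁅x⁆∣≡1 x) (cong₂ _+_ (∣⁅x⁆∣≡1 y) (∣⁅x⁆∣≡1 z)) ⟩
  3                                  ∎
  where open ℕ.≤-Reasoning

enumerate : ∀ {N} {p : Subset N} {a : Fin N} → ∣ p ∣ ≤ 3 → a ∈ p →
            (∀ {k} → k ∈ p → k ∈ᵗ (a , a , a)) ⊎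
            Σ[ b ∈ Fin N ] Σ[ c ∈ Fin N ]
              a ≢ b × a ≢ c × (∀ {k} → k ∈ p → k ∈ᵗ (a , b , c))
enumerate {p = p} {a} size a∈p with nonempty? (p - a)
... | no p-a=∅ = inj₁ onlyA
  where
  onlyA : ∀ {k} → k ∈ p → k ∈ᵗ (a , a , a)
  onlyA k∈p with split a k∈p
  ... | inj₁ k≡a  = inj₁ k≡a
  ... | inj₂ k∈p' = ⊥-elim (p-a=∅ (_ , k∈p'))
... | yes (b , b∈p-a) with nonempty? (p - a - b)
...   | no p-a-b=∅ = inj₂ (b , b , b≢a ∘ sym , b≢a ∘ sym , amongAB)
  where
  b≢a : b ≢ a
  b≢a = y∈p-x⇒y≢x b∈p-a
  amongAB : ∀ {k} → k ∈ p → k ∈ᵗ (a , b , b)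
  amongAB k∈p with split a k∈p
  ... | inj₁ k≡a = inj₁ k≡a
  ... | inj₂ k∈p' with split b k∈p'
  ...   | inj₁ k≡b   = inj₂ (inj₁ k≡b)
  ...   | inj₂ k∈p'' = ⊥-elim (p-a-b=∅ (_ , k∈p''))
...   | yes (c , c∈p-a-b) =
  inj₂ (b , c , y∈p-x⇒y≢x b∈p-a ∘ sym , y∈p-x⇒y≢x (p─q⊆p (p - a) ⁅ b ⁆ c∈p-a-b) ∘ sym , amongABC)
  where
  noFourth : ∀ {k} → k ∈ p - a - b - c → ⊥
  noFourth k∈p''' = ℕ.<⇒≱ sizeBound size
    where
    sizeBound : 4 ≤ ∣ p ∣
    sizeBound =
      ℕ.≤-trans (s≤s (ℕ.≤-trans (s≤s (ℕ.≤-trans (s≤s (x∈p⇒1≤∣p∣ k∈p'''))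
                                                   (x∈p⇒∣p-x∣<∣p∣ c∈p-a-b)))
                                 (x∈p⇒∣p-x∣<∣p∣ b∈p-a)))
                (x∈p⇒∣p-x∣<∣p∣ a∈p)
  amongABC : ∀ {k} → k ∈ p → k ∈ᵗ (a , b , c)
  amongABC k∈p with split a k∈p
  ... | inj₁ k≡a = inj₁ k≡a
  ... | inj₂ k∈p' with split b k∈p'
  ...   | inj₁ k≡b = inj₂ (inj₁ k≡b)
  ...   | inj₂ k∈p'' with split c k∈p''
  ...     | inj₁ k≡c    = inj₂ (inj₂ k≡c)
  ...     | inj₂ k∈p''' = ⊥-elim (noFourth k∈p''')

module _ {n M q : ℕ} (C : Code n M q) where

  Included : ℕ → Set
  Included t = (C₀ C' : Subset M) → 1 ≤ ∣ C₀ ∣ → ∣ C₀ ∣ ≤ t →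
               SameDesc C C' C₀ → C₀ ⊆ C'

  -- Strong separability says exactly this, since C₀ is one of the sets
  -- intersected.
  ssc⇔included : ∀ t → IsSSC C t ⇔ Included t
  ssc⇔included t = mk⇔ toIncluded fromIncluded
    where
    toIncluded : IsSSC C t → Included t
    toIncluded ssc C₀ C' size≥1 size≤t same {j} j∈C₀ =
      Equivalence.from (ssc C₀ size≥1 size≤t j) j∈C₀ C' same
    fromIncluded : Included t → IsSSC C t
    fromIncluded incl C₀ size≥1 size≤t j =
      mk⇔ (λ j∈⋂ → j∈⋂ C₀ (λ _ → mk⇔ id id))
          (λ j∈C₀ C' same → incl C₀ C' size≥1 size≤t same j∈C₀)

  included⇒sc : ∀ t → Included t → IsSC C t
  included⇒sc t incl C₁ C₂ size₁≥1 size₁≤t size₂≥1 size₂≤t C₁≢C₂ same =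
    C₁≢C₂ (⊆-antisym (incl C₁ C₂ size₁≥1 size₁≤t same⁻¹) (incl C₂ C₁ size₂≥1 size₂≤t same))
    where
    same⁻¹ : SameDesc C C₂ C₁
    same⁻¹ w = mk⇔ (Equivalence.from (same w)) (Equivalence.to (same w))

module Length3 {q M : ℕ} (C : Code 3 M q) where

  W : Fin M → Fin 3 → Fin q
  W x m = lookup (word C x) m

  Among : Fin q → Fin 3 → Triple M → Set
  Among u m (x , y , z) = u ≡ W x m ⊎ u ≡ W y m ⊎ u ≡ W z m

  among⁺ : ∀ {u m t} (T : Triple M) → t ∈ᵗ T → u ≡ W t m → Among u m T
  among⁺ (x , y , z) (inj₁ refl)        e = inj₁ e
  among⁺ (x , y , z) (inj₂ (inj₁ refl)) e = inj₂ (inj₁ e)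
  among⁺ (x , y , z) (inj₂ (inj₂ refl)) e = inj₂ (inj₂ e)

  among⁻ : ∀ {u m} (T : Triple M) → Among u m T → Σ[ t ∈ Fin M ] t ∈ᵗ T × u ≡ W t m
  among⁻ (x , y , z) (inj₁ e)        = x , inj₁ refl , e
  among⁻ (x , y , z) (inj₂ (inj₁ e)) = y , inj₂ (inj₁ refl) , e
  among⁻ (x , y , z) (inj₂ (inj₂ e)) = z , inj₂ (inj₂ refl) , e

  Below : Fin M → Triple M → Set
  Below w T = ∀ m → Among (W w m) m T

  below₁ : ∀ {x y z} → Below x (x , y , z)
  below₁ m = inj₁ refl

  below₂ : ∀ {x y z} → Below y (x , y , z)
  below₂ m = inj₂ (inj₁ refl)

  below₃ : ∀ {x y z} → Below z (x , y , z)
  below₃ m = inj₂ (inj₂ refl)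

  below-swap : ∀ {w x y z} → Below w (x , y , z) → Below w (x , z , y)
  below-swap below m = map₂ swap⊎ (below m)

  Covers : Triple M → Triple M → Set
  Covers (x , y , z) T' = Below x T' × Below y T' × Below z T'

  covered : ∀ {k} (T : Triple M) {T'} → Covers T T' → k ∈ᵗ T → Below k T'
  covered (x , y , z) (x≺ , y≺ , z≺) (inj₁ refl)        = x≺
  covered (x , y , z) (x≺ , y≺ , z≺) (inj₂ (inj₁ refl)) = y≺
  covered (x , y , z) (x≺ , y≺ , z≺) (inj₂ (inj₂ refl)) = z≺

  covers⇒desc : ∀ {T T'} → Covers T T' → ∀ v → InDesc C ⟦ T ⟧ v → InDesc C ⟦ T' ⟧ v
  covers⇒desc {T} {T'} cov v desc i with desc i
  ... | j , j∈T , j≈v with among⁻ T' (covered T cov (∈⟦⟧⁻ T j∈T) i)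
  ...   | t , t∈T' , j≈t = t , ∈⟦⟧⁺ T' t∈T' , trans (sym j≈t) j≈v

  Lone : Fin 3 → Fin M → Fin M → Fin M → Set
  Lone m u v v' = ¬ (W u m ≡ W v m ⊎ W u m ≡ W v' m)

  shares? : ∀ u v v' m → Dec (W u m ≡ W v m ⊎ W u m ≡ W v' m)
  shares? u v v' m = (W u m ≟ W v m) ⊎-dec (W u m ≟ W v' m)

  record Transversal (a w : Fin M) (i j k : Fin 3) (y x : Fin M) : Set where
    field
      w≢a   : w ≢ a
      atI   : W w i ≡ W a i
      atJ   : W w j ≡ W y j
      atK   : W w k ≡ W x k
      loneI : Lone i a y x
      loneJ : Lone j y a x
      loneK : Lone k x a y

  module _ {a w : Fin M} {i j k : Fin 3} {y x : Fin M} (T : Transversal a w i j k y x) where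
    open Transversal T

    i≢j : i ≢ j
    i≢j refl = loneI (inj₁ (trans (sym atI) atJ))

    i≢k : i ≢ k
    i≢k refl = loneI (inj₂ (trans (sym atI) atK))

    j≢k : j ≢ k
    j≢k refl = loneJ (inj₂ (trans (sym atJ) atK))

    transversal-below : Below w (a , y , x)
    transversal-below = byCoordinate i≢j i≢k j≢k (inj₁ atI) (inj₂ (inj₁ atJ)) (inj₂ (inj₂ atK))

    flip : Transversal a w i k j x y
    flip = record { w≢a = w≢a ; atI = atI ; atJ = atK ; atK = atJ
                  ; loneI = loneI ∘ swap⊎ ; loneJ = loneK ; loneK = loneJ }

    locate : ∀ {i' k'} → i ≢ i' → i ≢ k' → i' ≢ k' →
             Transversal a w i i' k' y x ⊎ Transversal a w i k' i' y x
    locate i≢i' i≢k' i'≢k' with cover3 i≢i' i≢k' i'≢k' j | cover3 i≢i' i≢k' i'≢k' k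
    ... | inj₁ refl        | _                = ⊥-elim (i≢j refl)
    ... | _                | inj₁ refl        = ⊥-elim (i≢k refl)
    ... | inj₂ (inj₁ refl) | inj₂ (inj₁ refl) = ⊥-elim (j≢k refl)
    ... | inj₂ (inj₁ refl) | inj₂ (inj₂ refl) = inj₁ T
    ... | inj₂ (inj₂ refl) | inj₂ (inj₁ refl) = inj₂ T
    ... | inj₂ (inj₂ refl) | inj₂ (inj₂ refl) = ⊥-elim (j≢k refl)

  Echoes : Fin M → Fin M → Fin M → Set
  Echoes a b c = ∀ i → Σ[ w ∈ Fin M ] w ≢ a × W w i ≡ W a i × Below w (a , b , c)

  -- If a ∈ C₀ ⊆ {a, b, c} is missing from C' while desc C' = desc C₀, then a is
  -- echoed by codewords of C': a ∈ desc C', and every word of C' is in desc C₀.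
  echoes : ∀ {C₀ C' : Subset M} {a b c} → (∀ {k} → k ∈ C₀ → k ∈ᵗ (a , b , c)) →
           SameDesc C C' C₀ → a ∈ C₀ → a ∉ C' → Echoes a b c
  echoes {C₀} {C'} {a} {b} {c} C₀⊆abc same a∈C₀ a∉C' i
    with Equivalence.from (same (word C a)) (λ _ → a , a∈C₀ , refl) i
  ... | w , w∈C' , atI = w , (λ w≡a → a∉C' (subst (_∈ C') w≡a w∈C')) , atI , descendant
    where
    descendant : Below w (a , b , c)
    descendant m with Equivalence.to (same (word C w)) (λ _ → w , w∈C' , refl) m
    ... | k , k∈C₀ , k≈w = among⁺ (a , b , c) (C₀⊆abc k∈C₀) (sym k≈w)

  echo-swap : ∀ {a b c} → Echoes a b c → Echoes a c b
  echo-swap echo i with echo i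
  ... | w , w≢a , atI , below = w , w≢a , atI , below-swap below

  module _ (sc : IsSC C 3) where

    -- The basic contradiction: two triples covering each other letter by letter
    -- have the same descendant set, so by 3̄-separability they are the same set,
    -- which fails when the first word of one is not in the other.
    separate : ∀ {x y z x' y' z'} → Covers (x , y , z) (x' , y' , z') →
               Covers (x' , y' , z') (x , y , z) → x ≢ x' → x ≢ y' → x ≢ z' → ⊥
    separate {x} {y} {z} {x'} {y'} {z'} cov cov' x≢x' x≢y' x≢z' =
      sc ⟦ T ⟧ ⟦ T' ⟧ (x∈p⇒1≤∣p∣ x∈T) (∣⟦⟧∣≤3 T) (x∈p⇒1≤∣p∣ (∈⟦⟧⁺ T' (inj₁ refl))) (∣⟦⟧∣≤3 T')
         differ (λ v → mk⇔ (covers⇒desc cov v) (covers⇒desc cov' v))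
      where
      T T' : Triple M
      T  = x , y , z
      T' = x' , y' , z'
      x∈T : x ∈ ⟦ T ⟧
      x∈T = ∈⟦⟧⁺ T (inj₁ refl)
      differ : ⟦ T ⟧ ≢ ⟦ T' ⟧
      differ T≡T' with ∈⟦⟧⁻ T' (subst (x ∈_) T≡T' x∈T)
      ... | inj₁ x≡x'        = x≢x' x≡x'
      ... | inj₂ (inj₁ x≡y') = x≢y' x≡y'
      ... | inj₂ (inj₂ x≡z') = x≢z' x≡z'

    -- A descendant w ≠ a of {a, y, x} repeating a's letter at a coordinate
    -- where x differs from a must elsewhere take a letter of y that is lone:
    -- otherwise w would be a descendant of {a, x}, and {w, a, x}, {a, x} would
    -- cover each other.
    escape : ∀ {a w y x i} → Below w (a , y , x) → w ≢ a → W w i ≡ W a i → W a i ≢ W x i →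
             Σ[ j ∈ Fin 3 ] W w j ≡ W y j × Lone j y a x
    escape {a} {w} {y} {x} {i} below w≢a atI ai≢xi
      with all? (shares? w a x)
    ... | yes inAX = ⊥-elim (separate (fromAX , below₁ , below₂) (below₂ , below₃ , below₃) w≢a w≢x w≢x)
      where
      fromAX : Below w (a , x , x)
      fromAX m = map₂ inj₁ (inAX m)
      w≢x : w ≢ x
      w≢x w≡x = ai≢xi (trans (sym atI) (cong (λ t → W t i) w≡x))
    ... | no notAX with ¬∀⟶∃¬ 3 _ (shares? w a x) notAX
    ...   | j , wj∉ax with below j
    ...     | inj₁ wj≡aj        = ⊥-elim (wj∉ax (inj₁ wj≡aj))
    ...     | inj₂ (inj₂ wj≡xj) = ⊥-elim (wj∉ax (inj₂ wj≡xj))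
    ...     | inj₂ (inj₁ wj≡yj) = j , wj≡yj , [ wj∉ax ∘ inj₁ ∘ trans wj≡yj , wj∉ax ∘ inj₂ ∘ trans wj≡yj ]′

    -- Transversals at i and j that differ by exchanging a and y agree at the
    -- third coordinate, so {w, a, y} and {w', a, y} cover each other.
    swapped : ∀ {a w w' i j k y x} → Transversal a w i j k y x → Transversal a w' j i k y x → ⊥
    swapped {a} {w} {w'} {i} {y = y} T T' =
      separate (reroute T T' , below₂ , below₃) (reroute T' T , below₂ , below₃) w≢w' T.w≢a w≢y
      where
      module T = Transversal T
      module T' = Transversal T'
      reroute : ∀ {v v' i j k x} → Transversal a v i j k y x → Transversal a v' j i k y x →
                Below v (v' , a , y)
      reroute S S' = byCoordinate (i≢j S) (i≢k S) (j≢k S)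
        (inj₂ (inj₁ (Transversal.atI S))) (inj₂ (inj₂ (Transversal.atJ S)))
        (inj₁ (trans (Transversal.atK S) (sym (Transversal.atK S'))))
      w≢w' : w ≢ w'
      w≢w' w≡w' = T.loneI (inj₁ (trans (sym T.atI) (trans (cong (λ t → W t i) w≡w') T'.atJ)))
      w≢y : w ≢ y
      w≢y w≡y = T.loneI (inj₁ (trans (sym T.atI) (cong (λ t → W t i) w≡y)))

    -- Three transversals at i, j, k forming a Latin square: {a, y, x} and
    -- {w, w', w''} cover each other.
    rotation : ∀ {a w w' w'' i j k y x} → Transversal a w i j k y x →
               Transversal a w' j k i y x → Transversal a w'' k i j y x → ⊥
    rotation {a} {w} {w'} {w''} {i} {j} {k} {y} {x} T T' T'' =
      separate (coverA , coverY , coverX) (transversal-below T , transversal-below T' , transversal-below T'')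
               (T.w≢a ∘ sym) (T'.w≢a ∘ sym) (T''.w≢a ∘ sym)
      where
      module T = Transversal T
      module T' = Transversal T'
      module T'' = Transversal T''
      coverA : Below a (w , w' , w'')
      coverA = byCoordinate (i≢j T) (i≢k T) (j≢k T)
        (inj₁ (sym T.atI)) (inj₂ (inj₁ (sym T'.atI))) (inj₂ (inj₂ (sym T''.atI)))
      coverY : Below y (w , w' , w'')
      coverY = byCoordinate (i≢j T) (i≢k T) (j≢k T)
        (inj₂ (inj₂ (sym T''.atJ))) (inj₁ (sym T.atJ)) (inj₂ (inj₁ (sym T'.atJ)))
      coverX : Below x (w , w' , w'')
      coverX = byCoordinate (i≢j T) (i≢k T) (j≢k T)
        (inj₂ (inj₁ (sym T'.atK))) (inj₂ (inj₂ (sym T''.atK))) (inj₁ (sym T.atK))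

    module Echo {a b c : Fin M} (echo : Echoes a b c) where

      transversal : ∀ {i} → Lone i a b c →
                    Σ[ w ∈ Fin M ] Σ[ j ∈ Fin 3 ] Σ[ k ∈ Fin 3 ] Transversal a w i j k b c
      transversal {i} loneI with echo i
      ... | w , w≢a , atI , below
        with escape below w≢a atI (loneI ∘ inj₂) | escape (below-swap below) w≢a atI (loneI ∘ inj₁)
      ...   | j , atJ , loneJ | k , atK , loneK =
        w , j , k , record { w≢a = w≢a ; atI = atI ; atJ = atJ ; atK = atK
                           ; loneI = loneI ; loneJ = loneJ ; loneK = loneK }

      -- Transversals at i and j in rotated position make the third coordinate k
      -- lone for a; the transversal at k closes a swap or a Latin square.
      rotated : ∀ {w w' i j k} → Transversal a w i j k b c → Transversal a w' j k i b c → ⊥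
      rotated {i = i} {j} {k} T T' with transversal loneK
        where
        loneK : Lone k a b c
        loneK = [ Transversal.loneJ T' ∘ inj₁ ∘ sym , Transversal.loneK T ∘ inj₁ ∘ sym ]′
      ... | _ , _ , _ , T₀ with locate T₀ (i≢k T ∘ sym) (j≢k T ∘ sym) (i≢j T)
      ...   | inj₁ T'' = rotation T T' T''
      ...   | inj₂ T'' = swapped T' T''

      -- A transversal at i whose b-coordinate j is also lone for a is impossible:
      -- the transversal at j is either swapped or rotated with respect to it.
      secondLone : ∀ {w i j k} → Transversal a w i j k b c → Lone j a b c → ⊥
      secondLone T loneJ with transversal loneJ
      ... | _ , _ , _ , T₀ with locate T₀ (i≢j T ∘ sym) (j≢k T) (i≢k T)
      ...   | inj₁ T' = swapped T T'
      ...   | inj₂ T' = rotated T T'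

    module _ {a b c : Fin M} (a≢b : a ≢ b) (a≢c : a ≢ c) (echo : Echoes a b c) where
      private
        module BC = Echo echo
        module CB = Echo (echo-swap echo)

      -- A descendant w ≠ a of {a, b, c} that, together with b and c, supplies
      -- every letter of a: then {a, b, c} and {w, b, c} cover each other.
      replace : ∀ {w} → Below w (a , b , c) → w ≢ a → Below a (w , b , c) → ⊥
      replace below w≢a cover =
        separate (cover , below₂ , below₃) (below , below₂ , below₃) (w≢a ∘ sym) a≢b a≢c

      -- If a has no lone coordinate, b replaces a.  Otherwise take the
      -- transversal at a lone coordinate i: if its b- or c-coordinate is lone
      -- for a as well, secondLone applies (after exchanging b and c in the
      -- latter case); if neither is, the transversal replaces a.
      noEchoes : ⊥
      noEchoes with all? (shares? a b c)
      ... | yes allShared = replace below₂ (a≢b ∘ sym) (inj₂ ∘ allShared)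
      ... | no notAll with ¬∀⟶∃¬ 3 _ (shares? a b c) notAll
      ...   | i , loneI with BC.transversal loneI
      ...     | w , j , k , T with shares? a b c j | shares? a b c k
      ...       | no loneJ | _        = BC.secondLone T loneJ
      ...       | yes _    | no loneK = CB.secondLone (flip T) (loneK ∘ swap⊎)
      ...       | yes sj   | yes sk   =
        replace (transversal-below T) (Transversal.w≢a T)
          (byCoordinate (i≢j T) (i≢k T) (j≢k T) (inj₁ (sym (Transversal.atI T))) (inj₂ sj) (inj₂ sk))

    -- Nor can a be echoed by descendants of {a}: an echo would equal a letterwise,
    -- so {w} and {a} would cover each other.
    noEchoes₁ : ∀ {a} → Echoes a a a → ⊥
    noEchoes₁ {a} echo with echo zero
    ... | w , w≢a , _ , below = separate (below , below , below) (back , back , back) w≢a w≢a w≢a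
      where
      back : Below a (w , w , w)
      back m = inj₁ (sym ([ id , [ id , id ]′ ]′ (below m)))

    included : Included C 3
    included C₀ C' _ size same {a} a∈C₀ with a ∈? C'
    ... | yes a∈C' = a∈C'
    ... | no a∉C' with enumerate size a∈C₀
    ...   | inj₁ C₀⊆a =
      ⊥-elim (noEchoes₁ (echoes C₀⊆a same a∈C₀ a∉C'))
    ...   | inj₂ (b , c , a≢b , a≢c , C₀⊆abc) =
      ⊥-elim (noEchoes a≢b a≢c (echoes C₀⊆abc same a∈C₀ a∉C'))

-- For codes of length 3, strong 3̄-separability coincides with 3̄-separability.
theorem1 : (q M : ℕ) → 3 ≤ q → (C : Code 3 M q) →
    IsSSC C 3 ⇔ IsSC C 3
theorem1 q M _ C = mk⇔
  (included⇒sc C 3 ∘ Equivalence.to (ssc⇔included C 3))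
  (Equivalence.from (ssc⇔included C 3) ∘ Length3.included C)
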